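{- Let $k$ and $m$ be positive integers. Then the function $n \mapsto p(n,k)$ is periodic modulo $m$: there exists a positive integer $L$ such that $p(n,k) \equiv p(n+L,k) \pmod m$ for all nonnegative integers $n$.
   Context: For a nonnegative integer $n$ and a positive integer $k$, $p(n,k)$ denotes the number of partitions of $n$ into parts each less than or equal to $k$ (so $p(0,k)=1$); equivalently, $\sum_{n\ge 0} p(n,k)q^n = \prod_{i=1}^{k} \frac{1}{1-q^i}$. -}

module Defs where

open import Data.Nat using (ℕ; zero; suc; _+_; _*_; _∸_; _≤?_)
open import Relation.Nullary.Decidable using (does)
open import Data.Bool using (if_then_else_)

-- Number of ways to write n as a multiset of parts, each part ≤ k:
-- classify by the multiplicity j of the largest allowed part k, giving
--   p(n,0) = [n = 0],   p(n,k) = Σ_{j ≥ 0, j*k ≤ n} p(n - j*k, k-1).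
-- This is the coefficient of q^n in ∏_{i=1}^{k} 1/(1-q^i).

sumMult : (ℕ → ℕ) → ℕ → ℕ → ℕ → ℕ
sumMult f k n zero    = f n
sumMult f k n (suc j) =
  sumMult f k n j + (if does (suc j * k ≤? n) then f (n ∸ suc j * k) else 0)

p : ℕ → ℕ → ℕ
p n zero    = if does (n ≤? 0) then 1 else 0
p n (suc k) = sumMult (λ r → p r k) (suc k) n n

module Submission where

-- Write K = k+1, g n = p(n,K) and f n = p(n,k).  Splitting off the parts
-- equal to K gives the recurrence  g(K+n) = f(K+n) + g(n)  (`p-recurrence`).
-- Iterating it N times gives  g(N·K + n) = B_N(n) + g(n),  where
-- B_N(n) = Σ_{i=1}^{N} f(i·K + n) is a block sum (`telescope`).
-- If f is L-periodic mod m (at least on positive arguments, which is all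
-- that holds for k = 0) then with T = L·K every block sum B_L is invariant
-- under n ↦ n + T, so g(c·T + n) ≡ c·B_L(n) + g(n) (mod m); taking c = m
-- shows that g is (m·L·K)-periodic mod m (`lift-periodicity`).
-- The theorem follows by induction on k, starting from p(n,0) = [n = 0],
-- which is constant (zero) on positive n.

open import Defs
open import Data.Nat using (ℕ; _+_; _%_; NonZero; _>_)
open import Data.Product using (Σ; _×_)
open import Relation.Binary.PropositionalEquality using (_≡_)

open import Data.Nat using (zero; suc; s≤s; _*_; _≤?_; _≤_; >-nonZero⁻¹)
open import Data.Nat.Properties
open import Data.Nat.DivMod using (%-distribˡ-+; [m+kn]%n≡m%n)
open import Data.Nat.Tactic.RingSolver using (solve-∀)
open import Data.Product using (_,_)
open import Relation.Nullary using (¬_; does)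
open import Relation.Nullary.Decidable using (dec-false; does-⇔)
open import Function.Bundles using (mk⇔)
open import Relation.Binary.PropositionalEquality
  using (refl; sym; trans; cong; cong₂; module ≡-Reasoning)

≤?-cancelˡ : ∀ a x n → does (a + x ≤? a + n) ≡ does (x ≤? n)
≤?-cancelˡ a x n = does-⇔ (mk⇔ (+-cancelˡ-≤ a x n) (+-monoʳ-≤ a)) (a + x ≤? a + n) (x ≤? n)

module SumMult (f : ℕ → ℕ) (k : ℕ) where
  K : ℕ
  K = suc k

  index-too-large : ∀ n d → ¬ (suc (n + d) * K ≤ n)
  index-too-large n d h = <-irrefl refl
    (≤-trans (s≤s (m≤m+n n d)) (≤-trans (m≤m*n (suc (n + d)) K) h))

  sumMult-beyond : ∀ n d → sumMult f K n (n + d) ≡ sumMult f K n n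
  sumMult-beyond n zero = cong (sumMult f K n) (+-identityʳ n)
  sumMult-beyond n (suc d) rewrite +-suc n d
    | dec-false (suc (n + d) * K ≤? n) (index-too-large n d)
    = trans (+-identityʳ _) (sumMult-beyond n d)

  -- At K + n, the term with index i+1 is the term of index i at n; the
  -- term with index 0 is f (K + n).
  sumMult-shift : ∀ n j → sumMult f K (K + n) (suc j) ≡ f (K + n) + sumMult f K n j
  sumMult-shift n zero
    rewrite ≤?-cancelˡ K 0 n | [m+n]∸[m+o]≡n∸o K n 0 = refl
  sumMult-shift n (suc j)
    rewrite sumMult-shift n j | ≤?-cancelˡ K (suc j * K) n
          | [m+n]∸[m+o]≡n∸o K n (suc j * K) = +-assoc (f (K + n)) _ _

-- Classifying partitions of K + n by whether they use a part K at all: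
-- p(K+n, K) = p(K+n, K-1) + p(n, K).
p-recurrence : ∀ k n → p (suc k + n) (suc k) ≡ p (suc k + n) k + p n (suc k)
p-recurrence k n = begin
  sumMult f K (K + n) (suc (k + n))      ≡⟨ sumMult-shift n (k + n) ⟩
  f (K + n) + sumMult f K n (k + n)      ≡⟨ cong (λ j → f (K + n) + sumMult f K n j) (+-comm k n) ⟩
  f (K + n) + sumMult f K n (n + k)      ≡⟨ cong (f (K + n) +_) (sumMult-beyond n k) ⟩
  f (K + n) + sumMult f K n n            ∎
  where
  open ≡-Reasoning
  f : ℕ → ℕ
  f r = p r k
  open SumMult f k

module Modulo (m : ℕ) .{{_ : NonZero m}} where
  infix 4 _≈_
  _≈_ : ℕ → ℕ → Set
  a ≈ b = a % m ≡ b % m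

  +-cong : ∀ {a b c d} → a ≈ b → c ≈ d → a + c ≈ b + d
  +-cong {a} {b} {c} {d} a≈b c≈d = begin
    (a + c) % m              ≡⟨ %-distribˡ-+ a c m ⟩
    (a % m + c % m) % m      ≡⟨ cong₂ (λ x y → (x + y) % m) a≈b c≈d ⟩
    (b % m + d % m) % m      ≡⟨ %-distribˡ-+ b d m ⟨
    (b + d) % m              ∎
    where open ≡-Reasoning

  +-multiple : ∀ a c → a + m * c ≈ a
  +-multiple a c = trans (cong (λ x → (a + x) % m) (*-comm m c)) ([m+kn]%n≡m%n a c m)

  Periodic : ℕ → (ℕ → ℕ) → Set
  Periodic L f = ∀ n → f n ≈ f (n + L)

  PositivelyPeriodic : ℕ → (ℕ → ℕ) → Set
  PositivelyPeriodic L f = ∀ n → f (suc n) ≈ f (suc n + L)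

  periodic-multiple : ∀ {L} f → PositivelyPeriodic L f → ∀ c n → f (suc n) ≈ f (suc n + c * L)
  periodic-multiple f per zero n = cong (λ x → f x % m) (sym (+-identityʳ (suc n)))
  periodic-multiple {L} f per (suc c) n = begin
    f (suc n) % m                  ≡⟨ periodic-multiple f per c n ⟩
    f (suc n + c * L) % m          ≡⟨ per (n + c * L) ⟩
    f (suc n + c * L + L) % m      ≡⟨ cong (λ x → f x % m) (regroup n c L) ⟩
    f (suc n + suc c * L) % m      ∎
    where
    open ≡-Reasoning
    regroup : ∀ n c L → suc n + c * L + L ≡ suc n + suc c * L
    regroup = solve-∀

  module Lift (f g : ℕ → ℕ) (k : ℕ)
              (recurrence : ∀ n → g (suc k + n) ≡ f (suc k + n) + g n) where
    K : ℕ
    K = suc k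

    blockSum : ℕ → ℕ → ℕ
    blockSum zero    n = 0
    blockSum (suc N) n = f (K + (N * K + n)) + blockSum N n

    telescope : ∀ N n → g (N * K + n) ≡ blockSum N n + g n
    telescope zero n = refl
    telescope (suc N) n = begin
      g (K + N * K + n)                          ≡⟨ cong g (+-assoc K (N * K) n) ⟩
      g (K + (N * K + n))                        ≡⟨ recurrence (N * K + n) ⟩
      f (K + (N * K + n)) + g (N * K + n)        ≡⟨ cong (f (K + (N * K + n)) +_) (telescope N n) ⟩
      f (K + (N * K + n)) + (blockSum N n + g n) ≡⟨ +-assoc (f (K + (N * K + n))) _ _ ⟨
      blockSum (suc N) n + g n                   ∎
      where open ≡-Reasoning

    -- Every term of a block sum is evaluated at a positive argument, so a
    -- block sum is invariant under shifts by multiples of a positive period.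
    blockSum-shift : ∀ {L} → PositivelyPeriodic L f → ∀ N c n → blockSum N n ≈ blockSum N (c * L + n)
    blockSum-shift per zero c n = refl
    blockSum-shift {L} per (suc N) c n = +-cong term (blockSum-shift per N c n)
      where
      rearrange : ∀ k N n c L → suc (k + (N * suc k + n)) + c * L ≡ suc k + (N * suc k + (c * L + n))
      rearrange = solve-∀
      term : f (K + (N * K + n)) ≈ f (K + (N * K + (c * L + n)))
      term = trans (periodic-multiple f per c (k + (N * K + n)))
                   (cong (λ x → f x % m) (rearrange k N n c L))

    iterate-period : ∀ {L} → PositivelyPeriodic L f → ∀ c n →
                     g (c * (L * K) + n) ≈ c * blockSum L n + g n
    iterate-period per zero n = refl
    iterate-period {L} per (suc c) n = begin
      g (L * K + c * (L * K) + n) % m                          ≡⟨ cong (λ x → g x % m) (+-assoc (L * K) _ n) ⟩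
      g (L * K + (c * (L * K) + n)) % m                        ≡⟨ cong (_% m) (telescope L (c * (L * K) + n)) ⟩
      (blockSum L (c * (L * K) + n) + g (c * (L * K) + n)) % m ≡⟨ +-cong block (iterate-period per c n) ⟩
      (blockSum L n + (c * blockSum L n + g n)) % m            ≡⟨ cong (_% m) (+-assoc (blockSum L n) _ (g n)) ⟨
      (suc c * blockSum L n + g n) % m                         ∎
      where
      open ≡-Reasoning
      swap : ∀ c L K → c * K * L ≡ c * (L * K)
      swap = solve-∀
      block : blockSum L (c * (L * K) + n) ≈ blockSum L n
      block = sym (trans (blockSum-shift per L (c * K) n)
                         (cong (λ x → blockSum L (x + n) % m) (swap c L K)))

    -- Taking c = m: g is (m·L·K)-periodic modulo m.
    lift-periodicity : ∀ {L} → PositivelyPeriodic L f → Periodic (m * (L * K)) g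
    lift-periodicity {L} per n = sym (begin
      g (n + m * (L * K)) % m             ≡⟨ cong (λ x → g x % m) (+-comm n _) ⟩
      g (m * (L * K) + n) % m             ≡⟨ iterate-period per m n ⟩
      (m * blockSum L n + g n) % m        ≡⟨ cong (_% m) (+-comm (m * blockSum L n) (g n)) ⟩
      (g n + m * blockSum L n) % m        ≡⟨ +-multiple (g n) (blockSum L n) ⟩
      g n % m                             ∎)
      where open ≡-Reasoning

module PartitionPeriods (m : ℕ) .{{m≢0 : NonZero m}} where
  open Modulo m

  HasPeriod : (ℕ → ℕ) → Set
  HasPeriod f = Σ ℕ (λ L → NonZero L × Periodic L f)

  HasPositivePeriod : (ℕ → ℕ) → Set
  HasPositivePeriod f = Σ ℕ (λ L → NonZero L × PositivelyPeriodic L f)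

  lift-period : ∀ k → HasPositivePeriod (λ n → p n k) → HasPeriod (λ n → p n (suc k))
  lift-period k (L , L≢0 , per) =
    m * (L * suc k) , m*n≢0 m (L * suc k) {{m≢0}} {{m*n≢0 L (suc k) {{L≢0}}}} ,
    Lift.lift-periodicity (λ n → p n k) (λ n → p n (suc k)) k (p-recurrence k) per

  p-periodic : ∀ k → HasPeriod (λ n → p n (suc k))
  p-positively-periodic : ∀ k → HasPositivePeriod (λ n → p n k)

  p-periodic k = lift-period k (p-positively-periodic k)

  -- p(n,0) = 0 for every n > 0, so 1 is a positive period of p(·,0).
  p-positively-periodic zero    = 1 , _ , λ _ → refl
  p-positively-periodic (suc k) with p-periodic k
  ... | L , L≢0 , per = L , L≢0 , λ n → per (suc n)

theorem1p1 : (k m : ℕ) → k > 0 → .{{_ : NonZero m}} →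
    Σ ℕ (λ L → (L > 0) × ((n : ℕ) → p n k % m ≡ p (n + L) k % m))
theorem1p1 zero    m ()
theorem1p1 (suc k) m _ with PartitionPeriods.p-periodic m k
... | L , L≢0 , per = L , >-nonZero⁻¹ L {{L≢0}} , per
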